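{- Let $G$ be a connected co-biconvex graph with at least two vertices, let $U$ be its set of universal vertices, and let $\alpha_1,\alpha_2$ be the independence numbers of the auxiliary interval graphs $H_1,H_2$ of $G-U$ described in the context. Then: (i) if $|U|=1$ then $\gamma_{\times 2}(G)=3$; (ii) if $|U|\geq 2$ then $\gamma_{\times 2}(G)=2$; (iii) if $|U|=0$ and $\alpha_1+\alpha_2\geq 3$ then $\gamma_{\times 2}(G)=3$; (iv) if $|U|=0$ and $\alpha_1=\alpha_2=1$ then $\gamma_{\times 2}(G)=4$.
   Context: For a graph $G$ with vertices $v_1,\dots,v_n$, $M^*(G)$ is the $0,1$-matrix with entry $(i,j)=1$ iff $i=j$ or $v_iv_j\in E(G)$. $G$ is co-biconvex if the rows of $M^*(G)$ can be permuted so the 0's in every column are consecutive. A vertex is universal if adjacent to all others; $U$ denotes the set of universal vertices, and $G-U$ is again co-biconvex without universal vertices. For a co-biconvex graph $G'$ without universal vertices: fix an ordering $v_1,\dots,v_n$ (rows and columns of $M^*(G')$ in this order) in which the 0's of each column are consecutive; $C_1$ is the set of vertices whose column has its 0's below the diagonal and $C_2$ those whose column has its 0's above; they partition $V(G')$, are cliques, and we may take $C_1=\{v_1,\dots,v_r\}$, $C_2=\{v_{r+1},\dots,v_n\}$. For $v_i\in C_1$ (resp. $C_2$), if the 0's of column $i$ occupy rows $p,\dots,p+s$ (all in $C_2$, resp. all in $C_1$), set $I_i=[p,p+s]$. $H_1$ is the intersection graph of $\{I_i:v_i\in C_1\}$ and $H_2$ of $\{I_i: v_i\in C_2\}$; equivalently,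 two vertices of $C_1$ are adjacent in $H_1$ iff some vertex of $C_2$ is non-adjacent to both (symmetrically for $H_2$). $N_G[v]$ is the closed neighborhood; $D$ is a $k$-tuple dominating set if $|N_G[v]\cap D|\ge k$ for all $v$; $\gamma_{\times k}(G)$ is the minimum size of such a set. -}

module Defs where

open import Data.Nat using (ℕ; zero; suc; _+_)
import Data.Nat as ℕ
open import Data.Bool using (Bool; true; false; _∨_)
open import Data.Fin using (Fin; _≟_)
import Data.Fin as F
open import Data.Fin.Subset using (Subset; _∈_; _∩_; ∣_∣)
open import Data.Vec using (tabulate)
open import Data.Product using (Σ; ∃; _×_; _,_)
open import Relation.Nullary using (¬_; Dec; yes; no)
open import Relation.Nullary.Decidable using (⌊_⌋)
open import Relation.Binary.PropositionalEquality using (_≡_; _≢_)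
open import Function.Definitions using (Injective)
open import Function.Bundles using (_⇔_)
open import Data.Fin.Permutation using (Permutation′; _⟨$⟩ʳ_)

record Graph (n : ℕ) : Set where
  field
    adj    : Fin n → Fin n → Bool
    sym    : ∀ i j → adj i j ≡ adj j i
    irrefl : ∀ i → adj i i ≡ false
open Graph public

M* : ∀ {n} → Graph n → Fin n → Fin n → Bool
M* G i j = ⌊ i ≟ j ⌋ ∨ adj G i j

N[_]_ : ∀ {n} → Graph n → Fin n → Subset n
N[ G ] v = tabulate (λ w → M* G v w)

data Reach {n} (G : Graph n) : Fin n → Fin n → Set where
  here : ∀ {i} → Reach G i i
  step : ∀ {i j k} → adj G i k ≡ true → Reach G k j → Reach G i j

Connected : ∀ {n} → Graph n → Set
Connected G = ∀ i j → Reach G i j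

ConsecutiveZeros : ∀ {m n} → (Fin m → Fin n → Bool) → Fin n → Set
ConsecutiveZeros {m} A j =
  ∀ (a b c : Fin m) → a F.≤ b → b F.≤ c →
  A a j ≡ false → A c j ≡ false → A b j ≡ false

CoBiconvex : ∀ {n} → Graph n → Set
CoBiconvex {n} G =
  Σ (Permutation′ n) λ σ →
    ∀ j → ConsecutiveZeros (λ a j′ → M* G (σ ⟨$⟩ʳ a) j′) j

Universal : ∀ {n} → Graph n → Fin n → Set
Universal G v = ∀ w → w ≢ v → adj G v w ≡ true

KTupleDom : ∀ {n} → Graph n → ℕ → Subset n → Set
KTupleDom G k D = ∀ v → k ℕ.≤ ∣ (N[ G ] v) ∩ D ∣

IsKTupleDomNumber : ∀ {n} → Graph n → ℕ → ℕ → Set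
IsKTupleDomNumber G k m =
  (Σ _ λ D → KTupleDom G k D × ∣ D ∣ ≡ m) ×
  (∀ D → KTupleDom G k D → m ℕ.≤ ∣ D ∣)

-- An ordering v_1..v_m of G - U, given by ord : Fin m → Fin n
-- (position i ↦ vertex of G), listing each non-universal vertex exactly once.
-- Rows and columns of M*(G-U) are indexed by positions.

module _ {n : ℕ} (G : Graph n) {m : ℕ} (ord : Fin m → Fin n) where

  MU : Fin m → Fin m → Bool
  MU a b = M* G (ord a) (ord b)

  ValidOrdering : Set
  ValidOrdering =
    Injective _≡_ _≡_ ord ×
    (∀ a → ¬ Universal G (ord a)) ×
    (∀ v → ¬ Universal G v → ∃ λ a → ord a ≡ v) ×
    (∀ j → ConsecutiveZeros MU j)

  InC1 : Fin m → Set
  InC1 j = (∃ λ a → MU a j ≡ false) × (∀ a → MU a j ≡ false → j F.< a)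

  InC2 : Fin m → Set
  InC2 j = (∃ λ a → MU a j ≡ false) × (∀ a → MU a j ≡ false → a F.< j)

  -- intersection of the intervals I_i and I_j (I_i = rows of the 0's of column i)
  IntervalsMeet : Fin m → Fin m → Set
  IntervalsMeet i j = ∃ λ a → MU a i ≡ false × MU a j ≡ false

  -- independent set of the intersection graph of {I_i : i ∈ C} (C = C1 or C2)
  IndependentIn : (Fin m → Set) → Subset m → Set
  IndependentIn C S =
    (∀ i → i ∈ S → C i) ×
    (∀ i j → i ∈ S → j ∈ S → i ≢ j → ¬ IntervalsMeet i j)

  IsIndependenceNumber : (Fin m → Set) → ℕ → Set
  IsIndependenceNumber C α =
    (Σ _ λ S → IndependentIn C S × ∣ S ∣ ≡ α) ×
    (∀ S → IndependentIn C S → ∣ S ∣ ℕ.≤ α)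

-- If D
-- contains a non-universal vertex x, a non-neighbour of x needs two further members of D,
-- so ∣D∣ ≥ 3; if D contains two vertices with a common non-neighbour, ∣D∣ ≥ 4. Without
-- universal vertices the graph is covered by the cliques C₁ and C₂, two vertices of the
-- same Cᵢ have a common non-neighbour exactly when their intervals meet, and every
-- dominating set meets some Cᵢ; so when both α are 1 any D has ∣D∣ ≥ 4. The matching
-- dominating sets are: two universal vertices; a universal vertex with the ends of a
-- non-edge (co-biconvex graphs have no three pairwise non-adjacent vertices); two
-- vertices of C₁ with disjoint intervals plus a non-neighbour of one of them; and two
-- vertices from each clique, which exist by connectivity.

module Submission where

open import Defs hiding (sym)
open import Data.Nat using (ℕ; zero; suc; _≤_; _<_; _+_; z≤n; s≤s; s≤s⁻¹)
open import Data.Nat.Properties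
  using ( _≤?_; ≤-refl; ≤-reflexive; ≤-trans; ≤-<-trans; ≤-antisym; <⇒≤; ≰⇒>; <-asym; 1+n≰n
        ; +-suc; +-monoˡ-≤; +-monoʳ-≤ )
open import Data.Bool using (Bool; true; false)
open import Data.Bool.Properties using () renaming (_≟_ to _≟ᵇ_)
open import Data.Fin using (Fin; zero; suc; _≟_)
import Data.Fin as Fin
open import Data.Fin.Properties using (any?; suc-injective)
  renaming (_≤?_ to _≤ᶠ?_; ≤-total to ≤ᶠ-total)
open import Data.Fin.Subset
  using (Subset; _∈_; _⊆_; ∣_∣; ⁅_⁆; _∪_; _∩_; _-_; inside; outside; Nonempty)
  renaming (⊥ to ∅)
open import Data.Fin.Subset.Properties
  using ( x∈⁅x⁆; x∈⁅y⁆⇒x≡y; ∣⁅x⁆∣≡1; ∣⊥∣≡0; ∉⊥; ∣p∣≤∣x∷p∣; x∈p∪q⁺; x∈p∪q⁻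
        ; x∈p∩q⁺; x∈p∩q⁻; ∣p∩q∣≤∣q∣; p⊆q⇒∣p∣≤∣q∣; x∈p⇒∣p-x∣<∣p∣; x∈p∧x≢y⇒x∈p-y )
import Data.Vec.Base as Vec
open import Data.Vec.Properties using (lookup∘tabulate; []=⇒lookup; lookup⇒[]=)
open import Data.List using (List; []; _∷_; length; foldr)
open import Data.List.Relation.Unary.Any using (here; there)
open import Data.List.Membership.Propositional using () renaming (_∈_ to _∈ₗ_)
open import Data.Product using (_×_; _,_; ∃; ∃₂; proj₁; proj₂)
open import Data.Sum using (_⊎_; inj₁; inj₂; swap)
open import Data.Empty using (⊥; ⊥-elim)
open import Relation.Nullary using (¬_; Dec; yes; no; contradiction)
open import Relation.Nullary.Decidable using (_×-dec_)
open import Relation.Binary.PropositionalEquality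
  using (_≡_; _≢_; refl; sym; trans; cong; subst; ≢-sym)
open import Function.Bundles using (_⇔_; Equivalence)
open import Data.Fin.Permutation using (_⟨$⟩ʳ_; _⟨$⟩ˡ_; inverseʳ)

private
  variable
    n k : ℕ

fromList : List (Fin n) → Subset n
fromList = foldr (λ x p → ⁅ x ⁆ ∪ p) ∅

∈fromList⁺ : ∀ {x : Fin n} {xs} → x ∈ₗ xs → x ∈ fromList xs
∈fromList⁺ (here refl) = x∈p∪q⁺ (inj₁ (x∈⁅x⁆ _))
∈fromList⁺ (there x∈xs) = x∈p∪q⁺ (inj₂ (∈fromList⁺ x∈xs))

∈fromList⁻ : ∀ {x : Fin n} xs → x ∈ fromList xs → x ∈ₗ xs
∈fromList⁻ [] x∈⊥ = ⊥-elim (∉⊥ x∈⊥)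
∈fromList⁻ (y ∷ ys) x∈ with x∈p∪q⁻ ⁅ y ⁆ (fromList ys) x∈
... | inj₁ x∈⁅y⁆ = here (x∈⁅y⁆⇒x≡y y x∈⁅y⁆)
... | inj₂ x∈ys = there (∈fromList⁻ ys x∈ys)

∣p∪q∣≤∣p∣+∣q∣ : (p q : Subset n) → ∣ p ∪ q ∣ ≤ ∣ p ∣ + ∣ q ∣
∣p∪q∣≤∣p∣+∣q∣ Vec.[] Vec.[] = z≤n
∣p∪q∣≤∣p∣+∣q∣ (inside Vec.∷ p) (y Vec.∷ q) =
  s≤s (≤-trans (∣p∪q∣≤∣p∣+∣q∣ p q) (+-monoʳ-≤ ∣ p ∣ (∣p∣≤∣x∷p∣ y q)))
∣p∪q∣≤∣p∣+∣q∣ (outside Vec.∷ p) (outside Vec.∷ q) = ∣p∪q∣≤∣p∣+∣q∣ p q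
∣p∪q∣≤∣p∣+∣q∣ (outside Vec.∷ p) (inside Vec.∷ q)
  rewrite +-suc ∣ p ∣ ∣ q ∣ = s≤s (∣p∪q∣≤∣p∣+∣q∣ p q)

∣fromList∣≤length : (xs : List (Fin n)) → ∣ fromList xs ∣ ≤ length xs
∣fromList∣≤length {n} [] rewrite ∣⊥∣≡0 n = z≤n
∣fromList∣≤length (x ∷ xs) with ∣p∪q∣≤∣p∣+∣q∣ ⁅ x ⁆ (fromList xs)
... | bound rewrite ∣⁅x⁆∣≡1 x = ≤-trans bound (s≤s (∣fromList∣≤length xs))

nonempty : (p : Subset n) → 1 ≤ ∣ p ∣ → Nonempty p
nonempty (inside Vec.∷ p) _ = zero , Vec.here
nonempty (outside Vec.∷ p) 1≤∣p∣ with nonempty p 1≤∣p∣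
... | x , x∈p = suc x , Vec.there x∈p

twoMembers : (p : Subset n) → 2 ≤ ∣ p ∣ → ∃₂ λ x y → x ≢ y × x ∈ p × y ∈ p
twoMembers (inside Vec.∷ p) (s≤s 1≤∣p∣) with nonempty p 1≤∣p∣
... | y , y∈p = zero , suc y , (λ ()) , Vec.here , Vec.there y∈p
twoMembers (outside Vec.∷ p) 2≤∣p∣ with twoMembers p 2≤∣p∣
... | x , y , x≢y , x∈p , y∈p =
  suc x , suc y , (λ e → x≢y (suc-injective e)) , Vec.there x∈p , Vec.there y∈p

x∈p⇒0<∣p∣ : ∀ {x : Fin n} {p} → x ∈ p → 0 < ∣ p ∣
x∈p⇒0<∣p∣ x∈p = ≤-trans (s≤s z≤n) (x∈p⇒∣p-x∣<∣p∣ x∈p)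

twoMembers⇒2≤∣p∣ : ∀ {x y : Fin n} {p} → x ≢ y → x ∈ p → y ∈ p → 2 ≤ ∣ p ∣
twoMembers⇒2≤∣p∣ x≢y x∈p y∈p =
  ≤-trans (s≤s (x∈p⇒0<∣p∣ (x∈p∧x≢y⇒x∈p-y y∈p (≢-sym x≢y)))) (x∈p⇒∣p-x∣<∣p∣ x∈p)

⊆p-x⇒∣q∣<∣p∣ : ∀ {x : Fin n} {p q} → x ∈ p → q ⊆ p - x → ∣ q ∣ < ∣ p ∣
⊆p-x⇒∣q∣<∣p∣ x∈p q⊆p-x = ≤-<-trans (p⊆q⇒∣p∣≤∣q∣ q⊆p-x) (x∈p⇒∣p-x∣<∣p∣ x∈p)

module _ (G : Graph n) where

  M*-refl : ∀ v → M* G v v ≡ true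
  M*-refl v with v ≟ v
  ... | yes _ = refl
  ... | no v≢v = contradiction refl v≢v

  M*-sym : ∀ v w → M* G v w ≡ M* G w v
  M*-sym v w with v ≟ w | w ≟ v
  ... | yes _ | yes _ = refl
  ... | yes v≡w | no w≢v = contradiction (sym v≡w) w≢v
  ... | no v≢w | yes w≡v = contradiction (sym w≡v) v≢w
  ... | no _ | no _ = Graph.sym G v w

  adj⇒M* : ∀ {v w} → adj G v w ≡ true → M* G v w ≡ true
  adj⇒M* {v} {w} e with v ≟ w
  ... | yes _ = refl
  ... | no _ = e

  nonEdge⇒M* : ∀ {v w} → v ≢ w → adj G v w ≡ false → M* G v w ≡ false
  nonEdge⇒M* {v} {w} v≢w e with v ≟ w
  ... | yes v≡w = contradiction v≡w v≢w
  ... | no _ = e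

  M*-separates : ∀ {v x y} → M* G v x ≡ true → M* G v y ≡ false → x ≢ y
  M*-separates t f refl with trans (sym t) f
  ... | ()

  M*-separatesʳ : ∀ {v x y} → M* G x v ≡ true → M* G y v ≡ false → x ≢ y
  M*-separatesʳ t f refl with trans (sym t) f
  ... | ()

  M*≡false⇒≢ : ∀ {v w} → M* G v w ≡ false → v ≢ w
  M*≡false⇒≢ {v} f = M*-separates (M*-refl v) f

  M*⇒∈N[] : ∀ {v x} → M* G v x ≡ true → x ∈ N[ G ] v
  M*⇒∈N[] {v} {x} e = lookup⇒[]= x _ (trans (lookup∘tabulate (M* G v) x) e)

  ∈N[]⇒M* : ∀ {v x} → x ∈ N[ G ] v → M* G v x ≡ true
  ∈N[]⇒M* {v} {x} x∈N = trans (sym (lookup∘tabulate (M* G v) x)) ([]=⇒lookup x∈N)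

  NonNeighbour : Fin n → Set
  NonNeighbour x = ∃ λ w → M* G w x ≡ false

  CommonNonNeighbour : Fin n → Fin n → Set
  CommonNonNeighbour x y = ∃ λ w → M* G w x ≡ false × M* G w y ≡ false

  nonNeighbour? : ∀ x → Dec (NonNeighbour x)
  nonNeighbour? x = any? λ w → M* G w x ≟ᵇ false

  universal⇒M* : ∀ {u} → Universal G u → ∀ v → M* G v u ≡ true
  universal⇒M* {u} u-univ v with v ≟ u
  ... | yes _ = refl
  ... | no v≢u = trans (Graph.sym G v u) (u-univ v v≢u)

  nonNeighbour⇒¬universal : ∀ {w x} → M* G w x ≡ false → ¬ Universal G w
  nonNeighbour⇒¬universal {w} {x} f w-univ =
    M*-separates (trans (M*-sym w x) (universal⇒M* w-univ x)) f refl

  ¬nonNeighbour⇒universal : ∀ {x} → ¬ NonNeighbour x → Universal G x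
  ¬nonNeighbour⇒universal {x} none w w≢x with adj G x w in e
  ... | true = refl
  ... | false = contradiction (w , nonEdge⇒M* w≢x (trans (Graph.sym G w x) e)) none

  adj⇒≢ : ∀ {v w} → adj G v w ≡ true → v ≢ w
  adj⇒≢ {v} e refl with trans (sym e) (Graph.irrefl G v)
  ... | ()

  reach⇒neighbour : ∀ {v w} → Reach G v w → v ≢ w → ∃ λ u → adj G v u ≡ true
  reach⇒neighbour here v≢v = contradiction refl v≢v
  reach⇒neighbour (step {k = u} e _) _ = u , e

  ¬universal⇒nonNeighbour : ∀ {x} → ¬ Universal G x → NonNeighbour x
  ¬universal⇒nonNeighbour {x} ¬univ with nonNeighbour? x
  ... | yes found = found
  ... | no none = contradiction (¬nonNeighbour⇒universal none) ¬univ

  AtMostOneUniversal : Set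
  AtMostOneUniversal = ∀ {u v} → Universal G u → Universal G v → u ≡ v

  TwoNeighboursIn : (Fin n → Set) → Fin n → Set
  TwoNeighboursIn P v =
    ∃₂ λ x y → x ≢ y × (P x × M* G v x ≡ true) × (P y × M* G v y ≡ true)

module _ (G : Graph n) where

  KTupleDom₂-fromList : ∀ {xs} → (∀ v → TwoNeighboursIn G (_∈ₗ xs) v) →
    KTupleDom G 2 (fromList xs)
  KTupleDom₂-fromList twoNeighbours v with twoNeighbours v
  ... | x , y , x≢y , (x∈xs , vx) , (y∈xs , vy) =
    twoMembers⇒2≤∣p∣ x≢y (x∈p∩q⁺ (M*⇒∈N[] G vx , ∈fromList⁺ x∈xs))
                         (x∈p∩q⁺ (M*⇒∈N[] G vy , ∈fromList⁺ y∈xs))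

  KTupleDom₂⇒twoNeighbours : ∀ {D} → KTupleDom G 2 D → ∀ v → TwoNeighboursIn G (_∈ D) v
  KTupleDom₂⇒twoNeighbours {D} dom v with twoMembers (N[ G ] v ∩ D) (dom v)
  ... | x , y , x≢y , x∈N∩D , y∈N∩D with x∈p∩q⁻ _ D x∈N∩D | x∈p∩q⁻ _ D y∈N∩D
  ... | x∈N , x∈D | y∈N , y∈D = x , y , x≢y , (x∈D , ∈N[]⇒M* G x∈N) , (y∈D , ∈N[]⇒M* G y∈N)

  bounds⇒IsKTupleDomNumber : ∀ {m} → (∃ λ D → KTupleDom G k D × ∣ D ∣ ≤ m) →
    (∀ D → KTupleDom G k D → m ≤ ∣ D ∣) → IsKTupleDomNumber G k m
  bounds⇒IsKTupleDomNumber (D , dom , ∣D∣≤m) lower =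
    (D , dom , ≤-antisym ∣D∣≤m (lower D dom)) , lower

  KTupleDom⇒k≤∣D∣ : ∀ {D} → KTupleDom G k D → Fin n → k ≤ ∣ D ∣
  KTupleDom⇒k≤∣D∣ {D = D} dom v = ≤-trans (dom v) (∣p∩q∣≤∣q∣ (N[ G ] v) D)

  private
    N[]∩D⊆D-x : ∀ {D w x} → M* G w x ≡ false → N[ G ] w ∩ D ⊆ D - x
    N[]∩D⊆D-x {D} f y∈N∩D with x∈p∩q⁻ _ D y∈N∩D
    ... | y∈N , y∈D = x∈p∧x≢y⇒x∈p-y y∈D (M*-separates G (∈N[]⇒M* G y∈N) f)

  nonNeighbour∈D⇒k<∣D∣ : ∀ {D w x} → KTupleDom G k D →
    x ∈ D → M* G w x ≡ false → k < ∣ D ∣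
  nonNeighbour∈D⇒k<∣D∣ {w = w} dom x∈D f =
    ≤-<-trans (dom w) (⊆p-x⇒∣q∣<∣p∣ x∈D (N[]∩D⊆D-x f))

  commonNonNeighbour∈D⇒2+k≤∣D∣ : ∀ {D x y} → KTupleDom G k D → x ≢ y →
    x ∈ D → y ∈ D → CommonNonNeighbour G x y → 2 + k ≤ ∣ D ∣
  commonNonNeighbour∈D⇒2+k≤∣D∣ {k = k} {D = D} {x} {y} dom x≢y x∈D y∈D (w , fx , fy) =
    ≤-trans (s≤s k<∣D-x∣) (x∈p⇒∣p-x∣<∣p∣ x∈D)
    where
    N[]∩D⊆D-x-y : N[ G ] w ∩ D ⊆ D - x - y
    N[]∩D⊆D-x-y z∈N∩D = x∈p∧x≢y⇒x∈p-y (N[]∩D⊆D-x fx z∈N∩D)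
      (M*-separates G (∈N[]⇒M* G (proj₁ (x∈p∩q⁻ _ D z∈N∩D))) fy)
    k<∣D-x∣ : k < ∣ D - x ∣
    k<∣D-x∣ = ≤-<-trans (dom w) (⊆p-x⇒∣q∣<∣p∣ (x∈p∧x≢y⇒x∈p-y y∈D (≢-sym x≢y)) N[]∩D⊆D-x-y)

  atMostOneUniversal⇒3≤∣D∣ : ∀ {D} → AtMostOneUniversal G → Fin n → KTupleDom G 2 D → 3 ≤ ∣ D ∣
  atMostOneUniversal⇒3≤∣D∣ unique v dom with KTupleDom₂⇒twoNeighbours dom v
  ... | x , y , x≢y , (x∈D , _) , (y∈D , _) with nonNeighbour? G x | nonNeighbour? G y
  ... | yes (w , f) | _ = nonNeighbour∈D⇒k<∣D∣ dom x∈D f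
  ... | no _ | yes (w , f) = nonNeighbour∈D⇒k<∣D∣ dom y∈D f
  ... | no none-x | no none-y =
    contradiction (unique (¬nonNeighbour⇒universal G none-x) (¬nonNeighbour⇒universal G none-y))
                  x≢y

module _ (G : Graph n) where

  coBiconvex⇒¬independentTriple : CoBiconvex G → ∀ {x y z} →
    M* G x y ≡ false → M* G y z ≡ false → ¬ (M* G x z ≡ false)
  coBiconvex⇒¬independentTriple (σ , consecutive) = triple
    where
    pos : Fin n → Fin n
    pos v = σ ⟨$⟩ˡ v

    flip : ∀ {a b} → M* G a b ≡ false → M* G b a ≡ false
    flip {a} {b} f = trans (M*-sym G b a) f

    row : ∀ v j → M* G (σ ⟨$⟩ʳ pos v) j ≡ M* G v j
    row v j = cong (λ r → M* G r j) (inverseʳ σ)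

    -- column m has 0's in rows a and b, hence in row m itself
    middle : ∀ {a m b} → pos a Fin.≤ pos m → pos m Fin.≤ pos b →
      M* G a m ≡ false → M* G b m ≡ false → ⊥
    middle {a} {m} {b} a≤m m≤b fa fb =
      M*≡false⇒≢ G (trans (sym (row m m))
        (consecutive m (pos a) (pos m) (pos b) a≤m m≤b (trans (row a m) fa) (trans (row b m) fb)))
        refl

    triple : ∀ {x y z} → M* G x y ≡ false → M* G y z ≡ false → ¬ (M* G x z ≡ false)
    triple {x} {y} {z} fxy fyz fxz
      with ≤ᶠ-total (pos x) (pos y) | ≤ᶠ-total (pos y) (pos z) | ≤ᶠ-total (pos x) (pos z)
    ... | inj₁ x≤y | inj₁ y≤z | _        = middle x≤y y≤z fxy (flip fyz)
    ... | inj₁ x≤y | inj₂ z≤y | inj₁ x≤z = middle x≤z z≤y fxz fyz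
    ... | inj₁ x≤y | inj₂ z≤y | inj₂ z≤x = middle z≤x x≤y (flip fxz) (flip fxy)
    ... | inj₂ y≤x | inj₁ y≤z | inj₁ x≤z = middle y≤x x≤z (flip fxy) (flip fxz)
    ... | inj₂ y≤x | inj₁ y≤z | inj₂ z≤x = middle y≤z z≤x fyz fxz
    ... | inj₂ y≤x | inj₂ z≤y | _        = middle z≤y y≤x (flip fyz) fxy

  twoUniversals⇒γ×2≡2 : ∀ {u v} → Universal G u → Universal G v → u ≢ v →
    IsKTupleDomNumber G 2 2
  twoUniversals⇒γ×2≡2 {u} {v} u-univ v-univ u≢v =
    bounds⇒IsKTupleDomNumber G
      (_ , KTupleDom₂-fromList G dominated , ∣fromList∣≤length (u ∷ v ∷ []))
      (λ D dom → KTupleDom⇒k≤∣D∣ G dom u)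
    where
    dominated : ∀ w → TwoNeighboursIn G (_∈ₗ u ∷ v ∷ []) w
    dominated w = u , v , u≢v , (here refl , universal⇒M* G u-univ w)
                              , (there (here refl) , universal⇒M* G v-univ w)

  universalAndNonEdge⇒KTupleDom : CoBiconvex G → ∀ {u x y} → Universal G u → x ≢ u →
    M* G y x ≡ false → KTupleDom G 2 (fromList (u ∷ x ∷ y ∷ []))
  universalAndNonEdge⇒KTupleDom cb {u} {x} {y} u-univ x≢u fyx = KTupleDom₂-fromList G dominated
    where
    y≢u : y ≢ u
    y≢u = ≢-sym (M*-separates G (universal⇒M* G u-univ x) (trans (M*-sym G x y) fyx))

    dominated : ∀ v → TwoNeighboursIn G (_∈ₗ u ∷ x ∷ y ∷ []) v
    dominated v with M* G v x in fvx | M* G v y in fvy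
    ... | true | _ = x , u , x≢u , (there (here refl) , fvx) , (here refl , universal⇒M* G u-univ v)
    ... | false | true =
      y , u , y≢u , (there (there (here refl)) , fvy) , (here refl , universal⇒M* G u-univ v)
    ... | false | false =
      ⊥-elim (coBiconvex⇒¬independentTriple cb fvx (trans (M*-sym G x y) fyx) fvy)

  oneUniversal⇒γ×2≡3 : CoBiconvex G → AtMostOneUniversal G → ∀ {u x} → Universal G u → x ≢ u →
    IsKTupleDomNumber G 2 3
  oneUniversal⇒γ×2≡3 cb unique {u} {x} u-univ x≢u
    with ¬universal⇒nonNeighbour G (λ x-univ → x≢u (unique x-univ u-univ))
  ... | y , fyx =
    bounds⇒IsKTupleDomNumber G
      (_ , universalAndNonEdge⇒KTupleDom cb u-univ x≢u fyx , ∣fromList∣≤length (u ∷ x ∷ y ∷ []))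
      (λ D dom → atMostOneUniversal⇒3≤∣D∣ G unique u dom)

-- Graphs covered by two cliques

record TwoCliqueCover (G : Graph n) : Set₁ where
  field
    A B      : Fin n → Set
    A⊎B      : ∀ v → A v ⊎ B v
    A-clique : ∀ {v w} → A v → A w → M* G v w ≡ true
    B-clique : ∀ {v w} → B v → B w → M* G v w ≡ true

swapCover : {G : Graph n} → TwoCliqueCover G → TwoCliqueCover G
swapCover C = record
  { A = B ; B = A ; A⊎B = λ v → swap (A⊎B v) ; A-clique = B-clique ; B-clique = A-clique }
  where open TwoCliqueCover C

PairwiseCommonNonNeighbours : Graph n → (Fin n → Set) → Set
PairwiseCommonNonNeighbours G P = ∀ {x y} → P x → P y → x ≢ y → CommonNonNeighbour G x y

module _ {G : Graph n} (C : TwoCliqueCover G) where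
  open TwoCliqueCover C

  nonNeighbourOfA∈B : ∀ {x w} → A x → M* G w x ≡ false → B w
  nonNeighbourOfA∈B {w = w} Ax f with A⊎B w
  ... | inj₁ Aw = ⊥-elim (M*-separates G (A-clique Aw Ax) f refl)
  ... | inj₂ Bw = Bw

  dominatingTriple : ∀ {x y z} → A x → A y → x ≢ y → ¬ CommonNonNeighbour G x y →
    M* G z x ≡ false → KTupleDom G 2 (fromList (x ∷ y ∷ z ∷ []))
  dominatingTriple {x} {y} {z} Ax Ay x≢y none fzx = KTupleDom₂-fromList G dominated
    where
    Bz : B z
    Bz = nonNeighbourOfA∈B Ax fzx

    z≢x : z ≢ x
    z≢x = M*≡false⇒≢ G fzx

    z≢y : z ≢ y
    z≢y = ≢-sym (M*-separatesʳ G (A-clique Ay Ax) fzx)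

    dominated : ∀ v → TwoNeighboursIn G (_∈ₗ x ∷ y ∷ z ∷ []) v
    dominated v with A⊎B v
    ... | inj₁ Av =
      x , y , x≢y , (here refl , A-clique Av Ax) , (there (here refl) , A-clique Av Ay)
    ... | inj₂ Bv with M* G v x in fvx | M* G v y in fvy
    ... | true | _ = z , x , z≢x , (there (there (here refl)) , B-clique Bv Bz) , (here refl , fvx)
    ... | false | true =
      z , y , z≢y , (there (there (here refl)) , B-clique Bv Bz) , (there (here refl) , fvy)
    ... | false | false = contradiction (v , fvx , fvy) none

module _ {G : Graph n} (C : TwoCliqueCover G) (noUniversal : ∀ v → ¬ Universal G v) where
  open TwoCliqueCover C

  anotherInA : Connected G → ∀ {x} → A x → ∃ λ y → A y × y ≢ x
  anotherInA connected {x} Ax with ¬universal⇒nonNeighbour G (noUniversal x)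
  ... | b , fbx with reach⇒neighbour G (connected x b) (≢-sym (M*≡false⇒≢ G fbx))
  ... | u , xu with A⊎B u
  ... | inj₁ Au = u , Au , ≢-sym (adj⇒≢ G xu)
  ... | inj₂ Bu with ¬universal⇒nonNeighbour G (noUniversal u)
  ... | c , fcu =
    c , nonNeighbourOfA∈B (swapCover C) Bu fcu , ≢-sym (M*-separatesʳ G (adj⇒M* G xu) fcu)

module _ {G : Graph n} (C : TwoCliqueCover G) (noUniversal : ∀ v → ¬ Universal G v) where
  open TwoCliqueCover C

  dominatingQuadruple : Connected G → ∀ {x} → A x → ∃ λ D → KTupleDom G 2 D × ∣ D ∣ ≤ 4
  dominatingQuadruple connected {x} Ax
    with anotherInA C noUniversal connected Ax | ¬universal⇒nonNeighbour G (noUniversal x)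
  ... | y , Ay , y≢x | z , fzx
    with anotherInA (swapCover C) noUniversal connected (nonNeighbourOfA∈B C Ax fzx)
  ... | t , Bt , t≢z =
    _ , KTupleDom₂-fromList G dominated , ∣fromList∣≤length (x ∷ y ∷ z ∷ t ∷ [])
    where
    Bz : B z
    Bz = nonNeighbourOfA∈B C Ax fzx

    dominated : ∀ v → TwoNeighboursIn G (_∈ₗ x ∷ y ∷ z ∷ t ∷ []) v
    dominated v with A⊎B v
    ... | inj₁ Av = x , y , ≢-sym y≢x , (here refl , A-clique Av Ax)
                                      , (there (here refl) , A-clique Av Ay)
    ... | inj₂ Bv = z , t , ≢-sym t≢z , (there (there (here refl)) , B-clique Bv Bz)
                                      , (there (there (there (here refl))) , B-clique Bv Bt)

  -- A non-neighbour of a has two D-neighbours other than a: one of them lies in B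
  -- together with a, or both lie in A.
  memberOfB⇒4≤∣D∣ : PairwiseCommonNonNeighbours G A → PairwiseCommonNonNeighbours G B →
    ∀ {D a} → KTupleDom G 2 D → B a → a ∈ D → 4 ≤ ∣ D ∣
  memberOfB⇒4≤∣D∣ meetA meetB {a = a} dom Ba a∈D with ¬universal⇒nonNeighbour G (noUniversal a)
  ... | b , fba with KTupleDom₂⇒twoNeighbours G dom b
  ... | e₁ , e₂ , e₁≢e₂ , (e₁∈D , be₁) , (e₂∈D , be₂) with A⊎B e₁ | A⊎B e₂
  ... | inj₂ Be₁ | _ = commonNonNeighbour∈D⇒2+k≤∣D∣ G dom e₁≢a e₁∈D a∈D (meetB Be₁ Ba e₁≢a)
    where
    e₁≢a : e₁ ≢ a
    e₁≢a = M*-separates G be₁ fba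
  ... | inj₁ _ | inj₂ Be₂ = commonNonNeighbour∈D⇒2+k≤∣D∣ G dom e₂≢a e₂∈D a∈D (meetB Be₂ Ba e₂≢a)
    where
    e₂≢a : e₂ ≢ a
    e₂≢a = M*-separates G be₂ fba
  ... | inj₁ Ae₁ | inj₁ Ae₂ =
    commonNonNeighbour∈D⇒2+k≤∣D∣ G dom e₁≢e₂ e₁∈D e₂∈D (meetA Ae₁ Ae₂ e₁≢e₂)

twoCliqueCover⇒γ×2≡3 : {G : Graph n} (C : TwoCliqueCover G) → (∀ v → ¬ Universal G v) →
  let open TwoCliqueCover C in
  ∀ {x y} → A x → A y → x ≢ y → ¬ CommonNonNeighbour G x y → IsKTupleDomNumber G 2 3
twoCliqueCover⇒γ×2≡3 {G = G} C noUniversal {x} {y} Ax Ay x≢y none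
  with ¬universal⇒nonNeighbour G (noUniversal x)
... | z , fzx =
  bounds⇒IsKTupleDomNumber G
    (_ , dominatingTriple C Ax Ay x≢y none fzx , ∣fromList∣≤length (x ∷ y ∷ z ∷ []))
    (λ D dom → atMostOneUniversal⇒3≤∣D∣ G (λ u-univ _ → contradiction u-univ (noUniversal _)) x dom)

twoCliqueCover⇒γ×2≡4 : {G : Graph n} (C : TwoCliqueCover G) → (∀ v → ¬ Universal G v) →
  Connected G → let open TwoCliqueCover C in
  PairwiseCommonNonNeighbours G A → PairwiseCommonNonNeighbours G B →
  Fin n → IsKTupleDomNumber G 2 4
twoCliqueCover⇒γ×2≡4 {G = G} C noUniversal connected meetA meetB v =
  bounds⇒IsKTupleDomNumber G upper lower
  where
  open TwoCliqueCover C

  upper : ∃ λ D → KTupleDom G 2 D × ∣ D ∣ ≤ 4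
  upper with A⊎B v
  ... | inj₁ Av = dominatingQuadruple C noUniversal connected Av
  ... | inj₂ Bv = dominatingQuadruple (swapCover C) noUniversal connected Bv

  lower : ∀ D → KTupleDom G 2 D → 4 ≤ ∣ D ∣
  lower D dom with KTupleDom₂⇒twoNeighbours G dom v
  ... | a , _ , _ , (a∈D , _) , _ with A⊎B a
  ... | inj₁ Aa = memberOfB⇒4≤∣D∣ (swapCover C) noUniversal meetB meetA dom Aa a∈D
  ... | inj₂ Ba = memberOfB⇒4≤∣D∣ C noUniversal meetA meetB dom Ba a∈D

-- The cliques C₁ and C₂ of an ordering of G - U

VertexOf : ∀ {m} → (Fin m → Fin n) → (Fin m → Set) → Fin n → Set
VertexOf ord C v = ∃ λ a → ord a ≡ v × C a

module _ (G : Graph n) {m} (ord : Fin m → Fin n) (valid : ValidOrdering G ord) where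

  private
    M : Fin m → Fin m → Bool
    M = MU G ord

    consecutive : ∀ j → ConsecutiveZeros M j
    consecutive = proj₂ (proj₂ (proj₂ valid))

  columnZero : ∀ j → ∃ λ a → M a j ≡ false
  columnZero j with ¬universal⇒nonNeighbour G (proj₁ (proj₂ valid) j)
  ... | w , fw with proj₁ (proj₂ (proj₂ valid)) w (nonNeighbour⇒¬universal G fw)
  ... | a , refl = a , fw

  zerosAround⇒⊥ : ∀ {a j c} → a Fin.≤ j → j Fin.≤ c → M a j ≡ false → M c j ≡ false → ⊥
  zerosAround⇒⊥ {a} {j} {c} a≤j j≤c fa fc =
    M*≡false⇒≢ G (consecutive j a j c a≤j j≤c fa fc) refl

  zerosAfter : ∀ {j b} → j Fin.≤ b → M b j ≡ false → ∀ c → M c j ≡ false → j Fin.< c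
  zerosAfter {j} j≤b fb c fc with c ≤ᶠ? j
  ... | yes c≤j = ⊥-elim (zerosAround⇒⊥ c≤j j≤b fc fb)
  ... | no c≰j = ≰⇒> c≰j

  zerosBefore : ∀ {j b} → b Fin.≤ j → M b j ≡ false → ∀ c → M c j ≡ false → c Fin.< j
  zerosBefore {j} b≤j fb c fc with j ≤ᶠ? c
  ... | yes j≤c = ⊥-elim (zerosAround⇒⊥ b≤j j≤c fb fc)
  ... | no j≰c = ≰⇒> j≰c

  InC1⊎InC2 : ∀ j → InC1 G ord j ⊎ InC2 G ord j
  InC1⊎InC2 j with columnZero j
  ... | b , fb with b ≤ᶠ? j
  ... | yes b≤j = inj₂ ((b , fb) , zerosBefore b≤j fb)
  ... | no b≰j = inj₁ ((b , fb) , zerosAfter (<⇒≤ (≰⇒> b≰j)) fb)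

  InC1-clique : ∀ {i j} → InC1 G ord i → InC1 G ord j → M i j ≡ true
  InC1-clique {i} {j} (_ , after-i) (_ , after-j) with M i j in f
  ... | true = refl
  ... | false = ⊥-elim (<-asym (after-j i f) (after-i j (trans (M*-sym G (ord j) (ord i)) f)))

  InC2-clique : ∀ {i j} → InC2 G ord i → InC2 G ord j → M i j ≡ true
  InC2-clique {i} {j} (_ , before-i) (_ , before-j) with M i j in f
  ... | true = refl
  ... | false = ⊥-elim (<-asym (before-j i f) (before-i j (trans (M*-sym G (ord j) (ord i)) f)))

  independenceNumber≤1⇒commonNonNeighbours : ∀ {C α} → IsIndependenceNumber G ord C α → α ≤ 1 →
    PairwiseCommonNonNeighbours G (VertexOf ord C)
  independenceNumber≤1⇒commonNonNeighbours {C} (_ , maximal) α≤1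
                                            (i , refl , Ci) (j , refl , Cj) ord-i≢j
    with any? (λ a → (M a i ≟ᵇ false) ×-dec (M a j ≟ᵇ false))
  ... | yes (a , fai , faj) = ord a , fai , faj
  ... | no apart =
    contradiction (≤-trans 2≤∣S∣ (≤-trans (maximal S (members , separated)) α≤1)) 1+n≰n
    where
    i≢j : i ≢ j
    i≢j i≡j = ord-i≢j (cong ord i≡j)

    S : Subset m
    S = fromList (i ∷ j ∷ [])

    2≤∣S∣ : 2 ≤ ∣ S ∣
    2≤∣S∣ = twoMembers⇒2≤∣p∣ i≢j (∈fromList⁺ {xs = i ∷ j ∷ []} (here refl))
                                 (∈fromList⁺ {xs = i ∷ j ∷ []} (there (here refl)))

    members : ∀ k → k ∈ S → C k
    members k k∈S with ∈fromList⁻ (i ∷ j ∷ []) k∈S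
    ... | here refl = Ci
    ... | there (here refl) = Cj

    separated : ∀ k l → k ∈ S → l ∈ S → k ≢ l → ¬ IntervalsMeet G ord k l
    separated k l k∈S l∈S k≢l with ∈fromList⁻ (i ∷ j ∷ []) k∈S | ∈fromList⁻ (i ∷ j ∷ []) l∈S
    ... | here refl | here refl = contradiction refl k≢l
    ... | here refl | there (here refl) = apart
    ... | there (here refl) | here refl = λ (a , faj , fai) → apart (a , fai , faj)
    ... | there (here refl) | there (here refl) = contradiction refl k≢l

3≤m+n⇒2≤m⊎2≤n : ∀ {m n} → 3 ≤ m + n → 2 ≤ m ⊎ 2 ≤ n
3≤m+n⇒2≤m⊎2≤n {m} {n} 3≤m+n with 2 ≤? m
... | yes 2≤m = inj₁ 2≤m
... | no 2≰m = inj₂ (s≤s⁻¹ (≤-trans 3≤m+n (+-monoˡ-≤ n (s≤s⁻¹ (≰⇒> 2≰m)))))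

module _ (G : Graph n) {m} (ord : Fin m → Fin n) (valid : ValidOrdering G ord)
         (noUniversal : ∀ v → ¬ Universal G v) where

  ord-surjective : ∀ v → ∃ λ a → ord a ≡ v
  ord-surjective v = proj₁ (proj₂ (proj₂ valid)) v (noUniversal v)

  orderingCover : TwoCliqueCover G
  orderingCover = record
    { A = VertexOf ord (InC1 G ord)
    ; B = VertexOf ord (InC2 G ord)
    ; A⊎B = cover
    ; A-clique = λ { (a , refl , C1a) (b , refl , C1b) → InC1-clique G ord valid C1a C1b }
    ; B-clique = λ { (a , refl , C2a) (b , refl , C2b) → InC2-clique G ord valid C2a C2b }
    }
    where
    cover : ∀ v → VertexOf ord (InC1 G ord) v ⊎ VertexOf ord (InC2 G ord) v
    cover v with ord-surjective v
    ... | a , refl with InC1⊎InC2 G ord valid a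
    ... | inj₁ C1a = inj₁ (a , refl , C1a)
    ... | inj₂ C2a = inj₂ (a , refl , C2a)

  2≤independenceNumber⇒nonMeetingPair : ∀ {C α} → IsIndependenceNumber G ord C α → 2 ≤ α →
    ∃₂ λ x y → VertexOf ord C x × VertexOf ord C y × x ≢ y × ¬ CommonNonNeighbour G x y
  2≤independenceNumber⇒nonMeetingPair ((S , (members , separated) , ∣S∣≡α) , _) 2≤α
    with twoMembers S (subst (2 ≤_) (sym ∣S∣≡α) 2≤α)
  ... | i , j , i≢j , i∈S , j∈S =
    ord i , ord j , (i , refl , members i i∈S) , (j , refl , members j j∈S) ,
    (λ ord-i≡j → i≢j (proj₁ valid ord-i≡j)) , meet
    where
    meet : ¬ CommonNonNeighbour G (ord i) (ord j)
    meet (w , fwi , fwj) with ord-surjective w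
    ... | a , refl = separated i j i∈S j∈S i≢j (a , fwi , fwj)

  independenceNumbers⇒γ×2≡3 : ∀ {α₁ α₂} →
    IsIndependenceNumber G ord (InC1 G ord) α₁ → IsIndependenceNumber G ord (InC2 G ord) α₂ →
    3 ≤ α₁ + α₂ → IsKTupleDomNumber G 2 3
  independenceNumbers⇒γ×2≡3 I₁ I₂ 3≤α₁+α₂ with 3≤m+n⇒2≤m⊎2≤n 3≤α₁+α₂
  ... | inj₁ 2≤α₁ with 2≤independenceNumber⇒nonMeetingPair I₁ 2≤α₁
  ... | _ , _ , Ax , Ay , x≢y , none =
    twoCliqueCover⇒γ×2≡3 orderingCover noUniversal Ax Ay x≢y none
  independenceNumbers⇒γ×2≡3 I₁ I₂ 3≤α₁+α₂ | inj₂ 2≤α₂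
    with 2≤independenceNumber⇒nonMeetingPair I₂ 2≤α₂
  ... | _ , _ , Bx , By , x≢y , none =
    twoCliqueCover⇒γ×2≡3 (swapCover orderingCover) noUniversal Bx By x≢y none

  independenceNumbers⇒γ×2≡4 : Connected G → Fin n →
    IsIndependenceNumber G ord (InC1 G ord) 1 → IsIndependenceNumber G ord (InC2 G ord) 1 →
    IsKTupleDomNumber G 2 4
  independenceNumbers⇒γ×2≡4 connected v I₁ I₂ =
    twoCliqueCover⇒γ×2≡4 orderingCover noUniversal connected
      (independenceNumber≤1⇒commonNonNeighbours G ord valid I₁ ≤-refl)
      (independenceNumber≤1⇒commonNonNeighbours G ord valid I₂ ≤-refl) v

module _ (G : Graph n) (U : Subset n) (U⇔universal : ∀ v → (v ∈ U) ⇔ Universal G v) where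

  private
    toU : ∀ {v} → Universal G v → v ∈ U
    toU {v} = Equivalence.from (U⇔universal v)

    fromU : ∀ {v} → v ∈ U → Universal G v
    fromU {v} = Equivalence.to (U⇔universal v)

  ∣U∣≡0⇒noUniversal : ∣ U ∣ ≡ 0 → ∀ v → ¬ Universal G v
  ∣U∣≡0⇒noUniversal ∣U∣≡0 v v-univ with subst (0 <_) ∣U∣≡0 (x∈p⇒0<∣p∣ (toU v-univ))
  ... | ()

  ∣U∣≡1⇒universal : ∣ U ∣ ≡ 1 → ∃ (Universal G)
  ∣U∣≡1⇒universal ∣U∣≡1 with nonempty U (≤-reflexive (sym ∣U∣≡1))
  ... | u , u∈U = u , fromU u∈U

  ∣U∣≡1⇒atMostOneUniversal : ∣ U ∣ ≡ 1 → AtMostOneUniversal G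
  ∣U∣≡1⇒atMostOneUniversal ∣U∣≡1 {v} {w} v-univ w-univ with v ≟ w
  ... | yes v≡w = v≡w
  ... | no v≢w =
    contradiction (subst (2 ≤_) ∣U∣≡1 (twoMembers⇒2≤∣p∣ v≢w (toU v-univ) (toU w-univ))) 1+n≰n

  2≤∣U∣⇒twoUniversals : 2 ≤ ∣ U ∣ → ∃₂ λ u v → u ≢ v × Universal G u × Universal G v
  2≤∣U∣⇒twoUniversals 2≤∣U∣ with twoMembers U 2≤∣U∣
  ... | u , v , u≢v , u∈U , v∈U = u , v , u≢v , fromU u∈U , fromU v∈U

anotherFin : (u : Fin (suc (suc n))) → ∃ λ x → x ≢ u
anotherFin zero = suc zero , λ ()
anotherFin (suc u) = zero , λ ()

theorem4p7 : ∀ (n : ℕ) (G : Graph n) → 2 ≤ n → Connected G → CoBiconvex G →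
    (U : Subset n) → (∀ v → (v ∈ U) ⇔ Universal G v) →
    (∣ U ∣ ≡ 1 → IsKTupleDomNumber G 2 3) ×
    (2 ≤ ∣ U ∣ → IsKTupleDomNumber G 2 2) ×
    (∀ (m : ℕ) (ord : Fin m → Fin n) → ValidOrdering G ord →
      ∀ (α₁ α₂ : ℕ) →
      IsIndependenceNumber G ord (InC1 G ord) α₁ →
      IsIndependenceNumber G ord (InC2 G ord) α₂ →
      (∣ U ∣ ≡ 0 → 3 ≤ α₁ + α₂ → IsKTupleDomNumber G 2 3) ×
      (∣ U ∣ ≡ 0 → α₁ ≡ 1 → α₂ ≡ 1 → IsKTupleDomNumber G 2 4))
theorem4p7 _ G (s≤s (s≤s z≤n)) connected coBiconvex U U⇔universal =
  oneUniversal , twoUniversals , λ m ord valid α₁ α₂ I₁ I₂ →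
    (λ ∣U∣≡0 → independenceNumbers⇒γ×2≡3 G ord valid (noUniversal ∣U∣≡0) I₁ I₂) ,
    (λ { ∣U∣≡0 refl refl →
      independenceNumbers⇒γ×2≡4 G ord valid (noUniversal ∣U∣≡0) connected zero I₁ I₂ })
  where
  noUniversal : ∣ U ∣ ≡ 0 → ∀ v → ¬ Universal G v
  noUniversal = ∣U∣≡0⇒noUniversal G U U⇔universal

  oneUniversal : ∣ U ∣ ≡ 1 → IsKTupleDomNumber G 2 3
  oneUniversal ∣U∣≡1 with ∣U∣≡1⇒universal G U U⇔universal ∣U∣≡1
  ... | u , u-univ = oneUniversal⇒γ×2≡3 G coBiconvex
    (∣U∣≡1⇒atMostOneUniversal G U U⇔universal ∣U∣≡1) u-univ (proj₂ (anotherFin u))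

  twoUniversals : 2 ≤ ∣ U ∣ → IsKTupleDomNumber G 2 2
  twoUniversals 2≤∣U∣ with 2≤∣U∣⇒twoUniversals G U U⇔universal 2≤∣U∣
  ... | u , v , u≢v , u-univ , v-univ = twoUniversals⇒γ×2≡2 G u-univ v-univ u≢v
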